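{- Let $P_n$ be the path on $n$ vertices. For all $n\ge 3$, $f(P_n)=\left\lfloor\frac n2\right\rfloor$.
   Context: For a graph $G$, a separating path system of $G$ is a family of (edge sets of) paths in $G$ such that for every pair of distinct edges some member contains exactly one of them; $f(G)$ is the minimum size of such a family. -}

module Defs where

open import Data.Nat using (ℕ; suc; _<_; _≤_)
open import Data.Fin using (Fin; toℕ)
open import Data.List using (List; []; _∷_; length)
open import Data.List.Relation.Unary.Linked using (Linked)
open import Data.List.Relation.Unary.Unique.Propositional using (Unique)
open import Data.List.Membership.Propositional using (_∈_)
open import Data.Product using (Σ; _×_; _,_; ∃)
open import Data.Sum using (_⊎_)
open import Relation.Binary.PropositionalEquality using (_≡_)
open import Relation.Nullary using (¬_)

Graph : ℕ → Set₁
Graph n = Fin n → Fin n → Set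

PathGraph : (n : ℕ) → Graph n
PathGraph n i j = (suc (toℕ i) ≡ toℕ j) ⊎ (suc (toℕ j) ≡ toℕ i)

Edge : ∀ {n} → Graph n → Set
Edge {n} G = Σ (Fin n) λ u → Σ (Fin n) λ v → (toℕ u < toℕ v) × G u v

data Consec {A : Set} : List A → A → A → Set where
  here  : ∀ {x y xs} → Consec (x ∷ y ∷ xs) x y
  there : ∀ {z x y xs} → Consec xs x y → Consec (z ∷ xs) x y

record GPath {n : ℕ} (G : Graph n) : Set where
  constructor mkPath
  field
    verts    : List (Fin n)
    nonempty : ¬ (verts ≡ [])
    distinct : Unique verts
    linked   : Linked G verts
open GPath public

_∈E_ : ∀ {n} {G : Graph n} → Edge G → GPath G → Set
(u , v , _) ∈E p = Consec (verts p) u v ⊎ Consec (verts p) v u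

-- Distinctness of edges (as unordered pairs, via the normal form u < v).
_≢E_ : ∀ {n} {G : Graph n} → Edge G → Edge G → Set
(u , v , _) ≢E (u' , v' , _) = ¬ ((u ≡ u') × (v ≡ v'))

Separating : ∀ {n} (G : Graph n) → List (GPath G) → Set
Separating G 𝒫 = (e e' : Edge G) → e ≢E e' →
  ∃ λ p → p ∈ 𝒫 × ((e ∈E p × ¬ (e' ∈E p)) ⊎ (e' ∈E p × ¬ (e ∈E p)))

-- f(G) = k : k is the minimum size of a separating path system of G.
IsSepNumber : ∀ {n} (G : Graph n) → ℕ → Set
IsSepNumber G k =
  (∃ λ 𝒫 → Separating G 𝒫 × length 𝒫 ≡ k)
  × (∀ 𝒫 → Separating G 𝒫 → k ≤ length 𝒫)

-- A path of P_n is a monotone walk, so, indexing the edge {x, x + 1} by x, its edge set is an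
-- interval of [0, n - 1): separating the edges means separating n - 1 points by intervals.
-- The ⌊n/2⌋ windows [j, j + ⌊n/2⌋), j < ⌊n/2⌋, do this.  Conversely, an interval separating
-- x > 0 from x - 1 has an endpoint at x, and one separating 0 from n - 2 either starts at 0
-- or ends beyond n - 2; marking each point by such an endpoint is injective, so L intervals
-- separating n - 1 points satisfy n - 1 ≤ 2L, i.e. L ≥ ⌊n/2⌋.
module Submission where

open import Defs
open import Data.Nat using (ℕ; zero; suc; _+_; _*_; _∸_; _≤_; _<_; z≤n; s≤s; s≤s⁻¹; z<s; _<?_)
open import Data.Nat.Properties
open import Data.Nat.DivMod using (_/_; _%_; m≡m%n+[m/n]*n; m%n<n; m/n*n≤m; m<n*o⇒m/o<n)
open import Data.Fin using (Fin; toℕ; fromℕ<; join; splitAt)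
open import Data.Fin.Properties using (toℕ-injective; toℕ-fromℕ<; toℕ<n; injective⇒≤; splitAt-join)
open import Data.List using (List; []; _∷_; map; length; tabulate; lookup)
open import Data.List.Properties using (length-tabulate)
open import Data.List.Membership.Propositional using (_∈_)
open import Data.List.Membership.Propositional.Properties using (∈-tabulate⁺)
open import Data.List.Relation.Unary.All as All using (All; []; _∷_)
import Data.List.Relation.Unary.Any as Any
open import Data.List.Relation.Unary.Any.Properties using (lookup-index)
open import Data.List.Relation.Unary.AllPairs using ([]; _∷_)
open import Data.List.Relation.Unary.Linked using (Linked; []; [-]; _∷_)
import Data.List.Relation.Unary.Linked.Properties as Linked
open import Data.List.Relation.Unary.Unique.Propositional using (Unique)
import Data.List.Relation.Unary.Unique.Propositional.Properties as Unique
open import Data.Product using (Σ; _×_; _,_; ∃; proj₁; proj₂; map₂)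
open import Data.Sum as Sum using (_⊎_; inj₁; inj₂; swap)
open import Data.Empty using (⊥-elim)
open import Function using (_∘_; _⇔_; mk⇔; Equivalence)
open import Function.Definitions using (Injective)
import Function.Properties.Equivalence as ⇔
open import Relation.Binary.PropositionalEquality
open import Relation.Nullary using (¬_; yes; no)
open import Relation.Binary.Definitions using (tri<; tri≈; tri>)

open Equivalence using (to; from)

ExactlyOne : Set → Set → Set
ExactlyOne P Q = (P × ¬ Q) ⊎ (Q × ¬ P)

ExactlyOne-resp-⇔ : ∀ {P P′ Q Q′} → P ⇔ P′ → Q ⇔ Q′ → ExactlyOne P Q → ExactlyOne P′ Q′
ExactlyOne-resp-⇔ P⇔P′ Q⇔Q′ (inj₁ (p , ¬q)) = inj₁ (to P⇔P′ p , ¬q ∘ from Q⇔Q′)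
ExactlyOne-resp-⇔ P⇔P′ Q⇔Q′ (inj₂ (q , ¬p)) = inj₂ (to Q⇔Q′ q , ¬p ∘ from P⇔P′)

Interval : Set
Interval = ℕ × ℕ

_∈ᴵ_ : ℕ → Interval → Set
x ∈ᴵ I = proj₁ I ≤ x × x < proj₂ I

right-endpoint : ∀ {I y} → y ∈ᴵ I → ¬ suc y ∈ᴵ I → proj₂ I ≡ suc y
right-endpoint (a≤y , y<c) sy∉ = ≤-antisym (≮⇒≥ (λ sy<c → sy∉ (≤-trans a≤y (n≤1+n _) , sy<c))) y<c

left-endpoint : ∀ {I y} → ¬ y ∈ᴵ I → suc y ∈ᴵ I → proj₁ I ≡ suc y
left-endpoint y∉ (a≤sy , sy<c) = ≤-antisym a≤sy (≰⇒> (λ a≤y → y∉ (a≤y , <-trans (n<1+n _) sy<c)))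

window : ℕ → ℕ → Interval
window k j = j , k + j

windows-separate : ∀ {k x x′} → x < x′ → x′ < k + k →
  ∃ λ j → j < k × ExactlyOne (x ∈ᴵ window k j) (x′ ∈ᴵ window k j)
windows-separate {zero} x<x′ ()
windows-separate {k@(suc k′)} {x} {x′} x<x′ x′<2k with x′ <? k | x <? k
... | yes x′<k | _ = suc x , ≤-<-trans x<x′ x′<k , inj₂ (x′∈ , λ (sx≤x , _) → <-irrefl refl sx≤x)
  where
  x′∈ : x′ ∈ᴵ window k (suc x)
  x′∈ = x<x′ , <-≤-trans x′<k (m≤m+n k (suc x))
... | no x′≮k | yes x<k = 0 , z<s , inj₁ (x∈ , λ (_ , x′<k+0) → x′≮k (subst (x′ <_) k+0≡k x′<k+0))
  where
  k+0≡k : k + 0 ≡ k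
  k+0≡k = +-identityʳ k
  x∈ : x ∈ᴵ window k 0
  x∈ = z≤n , subst (x <_) (sym k+0≡k) x<k
... | no _ | no x≮k = j , m<n+o⇒m∸n<o (suc x) k (≤-<-trans x<x′ x′<2k) , inj₁ (x∈ , x′∉)
  where
  j : ℕ
  j = suc x ∸ k
  k+j≡sx : k + j ≡ suc x
  k+j≡sx = m+[n∸m]≡n (≤-trans (≮⇒≥ x≮k) (n≤1+n x))
  x∈ : x ∈ᴵ window k j
  x∈ = m∸n≤m x k′ , subst (x <_) (sym k+j≡sx) (n<1+n x)
  x′∉ : ¬ x′ ∈ᴵ window k j
  x′∉ (_ , x′<k+j) = <⇒≱ x′<k+j (subst (_≤ x′) (sym k+j≡sx) x<x′)

join-injective : ∀ m n → Injective _≡_ _≡_ (join m n)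
join-injective m n {s} {s′} eq = begin
  s                       ≡⟨ splitAt-join m n s ⟨
  splitAt m (join m n s)  ≡⟨ cong (splitAt m) eq ⟩
  splitAt m (join m n s′) ≡⟨ splitAt-join m n s′ ⟩
  s′                      ∎
  where open ≡-Reasoning

intervals-separating⇒≤ : ∀ {L m} (I : Fin L → Interval) → 2 ≤ m →
  (∀ {x x′} → x < x′ → x′ < m → ∃ λ j → ExactlyOne (x ∈ᴵ I j) (x′ ∈ᴵ I j)) →
  m ≤ L + L
intervals-separating⇒≤ {L} {m@(suc (suc m′))} I (s≤s (s≤s z≤n)) separates = injective⇒≤ code-injective
  where
  Marks : ℕ → Fin L ⊎ Fin L → Set
  Marks x (inj₁ j) = proj₁ (I j) ≡ x
  Marks x (inj₂ j) = proj₂ (I j) ≡ x ⊎ (x ≡ 0 × m ≤ proj₂ (I j))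

  mark : ∀ {x} → x < m → Σ (Fin L ⊎ Fin L) (Marks x)
  mark {zero} _ with separates {0} {suc m′} z<s ≤-refl
  ... | j , inj₁ ((a≤0 , _) , _) = inj₁ j , n≤0⇒n≡0 a≤0
  ... | j , inj₂ ((_ , m≤c) , _) = inj₂ j , inj₂ (refl , m≤c)
  mark {suc y} sy<m with separates (n<1+n y) sy<m
  ... | j , inj₁ (y∈ , sy∉) = inj₂ j , inj₁ (right-endpoint y∈ sy∉)
  ... | j , inj₂ (sy∈ , y∉) = inj₁ j , left-endpoint y∉ sy∈

  marks-injective : ∀ {x x′} s → x < m → x′ < m → Marks x s → Marks x′ s → x ≡ x′
  marks-injective (inj₁ _) _ _ a≡x a≡x′ = trans (sym a≡x) a≡x′
  marks-injective (inj₂ _) _ _ (inj₁ c≡x) (inj₁ c≡x′) = trans (sym c≡x) c≡x′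
  marks-injective (inj₂ _) _ _ (inj₂ (refl , _)) (inj₂ (refl , _)) = refl
  marks-injective (inj₂ _) x<m _ (inj₁ refl) (inj₂ (_ , m≤x)) = ⊥-elim (<⇒≱ x<m m≤x)
  marks-injective (inj₂ _) _ x′<m (inj₂ (_ , m≤x′)) (inj₁ refl) = ⊥-elim (<⇒≱ x′<m m≤x′)

  code : Fin m → Fin (L + L)
  code i = join L L (proj₁ (mark (toℕ<n i)))

  code-injective : Injective _≡_ _≡_ code
  code-injective {i} {i′} eq = toℕ-injective
    (marks-injective s (toℕ<n i) (toℕ<n i′) (proj₂ (mark (toℕ<n i)))
      (subst (Marks (toℕ i′)) (sym s≡s′) (proj₂ (mark (toℕ<n i′)))))
    where
    s : Fin L ⊎ Fin L
    s = proj₁ (mark (toℕ<n i))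
    s≡s′ : s ≡ proj₁ (mark (toℕ<n i′))
    s≡s′ = join-injective L L eq

Adjacent : ℕ → ℕ → Set
Adjacent x y = suc x ≡ y ⊎ suc y ≡ x

-- Ascending a c xs : the list a ∷ xs is a, a + 1, …, c.
data Ascending : ℕ → ℕ → List ℕ → Set where
  stop : ∀ {a} → Ascending a a []
  step : ∀ {a c xs} → Ascending (suc a) c xs → Ascending a c (suc a ∷ xs)

-- Descending a c xs : the list c ∷ xs is c, c ∸ 1, …, a.
data Descending : ℕ → ℕ → List ℕ → Set where
  stop : ∀ {a} → Descending a a []
  step : ∀ {a c xs} → Descending a c xs → Descending a (suc c) (c ∷ xs)

-- A walk that turned back would visit its current vertex twice.
ascending-or-descending : ∀ {x xs} → Unique (x ∷ xs) → Linked Adjacent (x ∷ xs) →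
  (∃ λ c → Ascending x c xs) ⊎ (∃ λ a → Descending a x xs)
ascending-or-descending {xs = []} _ _ = inj₁ (_ , stop)
ascending-or-descending (x∉ ∷ distinct) (inj₁ refl ∷ linked) with ascending-or-descending distinct linked
... | inj₁ (c , asc) = inj₁ (c , step asc)
... | inj₂ (_ , stop) = inj₁ (_ , step stop)
... | inj₂ (_ , step _) = ⊥-elim (All.head (All.tail x∉) refl)
ascending-or-descending (x∉ ∷ distinct) (inj₂ refl ∷ linked) with ascending-or-descending distinct linked
... | inj₂ (a , desc) = inj₂ (a , step desc)
... | inj₁ (_ , stop) = inj₂ (_ , step stop)
... | inj₁ (_ , step _) = ⊥-elim (All.head (All.tail x∉) refl)

ascending-above : ∀ {a c xs} → Ascending a c xs → All (a <_) xs
ascending-above stop = []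
ascending-above (step asc) = ≤-refl ∷ All.map (<-trans (n<1+n _)) (ascending-above asc)

ascending-≤ : ∀ {a c xs} → Ascending a c xs → All (_≤ c) (a ∷ xs)
ascending-≤ stop = ≤-refl ∷ []
ascending-≤ {a} {c} (step {xs = xs} asc) = ≤-trans (n≤1+n a) (All.head below) ∷ below
  where
  below : All (_≤ c) (suc a ∷ xs)
  below = ascending-≤ asc

ascending-unique : ∀ {a c xs} → Ascending a c xs → Unique (a ∷ xs)
ascending-unique stop = [] ∷ []
ascending-unique (step asc) = All.map <⇒≢ (ascending-above (step asc)) ∷ ascending-unique asc

ascending-linked : ∀ {a c xs} → Ascending a c xs → Linked Adjacent (a ∷ xs)
ascending-linked stop = [-]
ascending-linked (step asc) = inj₁ refl ∷ ascending-linked asc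

ascent : ℕ → ℕ → List ℕ
ascent a zero = []
ascent a (suc L) = suc a ∷ ascent (suc a) L

ascent-ascending : ∀ a L → Ascending a (L + a) (ascent a L)
ascent-ascending a zero = stop
ascent-ascending a (suc L) =
  step (subst (λ c → Ascending (suc a) c (ascent (suc a) L)) (+-suc L a) (ascent-ascending (suc a) L))

Traverses : {A : Set} → List A → A → A → Set
Traverses xs x y = Consec xs x y ⊎ Consec xs y x

n≢2+n : ∀ {n} → ¬ n ≡ suc (suc n)
n≢2+n ()

ascending-consec⁻ : ∀ {a c xs x y} → Ascending a c xs → Consec (a ∷ xs) x y → y ≡ suc x × x ∈ᴵ (a , c)
ascending-consec⁻ (step asc) here = refl , ≤-refl , All.head (ascending-≤ asc)
ascending-consec⁻ (step asc) (there xy) with ascending-consec⁻ asc xy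
... | y≡sx , sa≤x , x<c = y≡sx , <⇒≤ sa≤x , x<c

ascending-consec⁺ : ∀ {a c xs x} → Ascending a c xs → x ∈ᴵ (a , c) → Consec (a ∷ xs) x (suc x)
ascending-consec⁺ stop (a≤x , x<a) = ⊥-elim (<⇒≱ x<a a≤x)
ascending-consec⁺ (step asc) (a≤x , x<c) with m≤n⇒m<n∨m≡n a≤x
... | inj₁ a<x = there (ascending-consec⁺ asc (a<x , x<c))
... | inj₂ refl = here

ascending-traverses : ∀ {a c xs z} → Ascending a c xs → Traverses (a ∷ xs) z (suc z) ⇔ z ∈ᴵ (a , c)
ascending-traverses asc = mk⇔
  Sum.[ proj₂ ∘ ascending-consec⁻ asc
      , (λ backwards → ⊥-elim (n≢2+n (proj₁ (ascending-consec⁻ asc backwards)))) ]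
  (inj₁ ∘ ascending-consec⁺ asc)

descending-≤ : ∀ {a c xs} → Descending a c xs → a ≤ c
descending-≤ stop = ≤-refl
descending-≤ (step desc) = ≤-trans (descending-≤ desc) (n≤1+n _)

descending-consec⁻ : ∀ {a c xs x y} → Descending a c xs → Consec (c ∷ xs) y x → y ≡ suc x × x ∈ᴵ (a , c)
descending-consec⁻ (step desc) here = refl , descending-≤ desc , ≤-refl
descending-consec⁻ (step desc) (there yx) with descending-consec⁻ desc yx
... | y≡sx , a≤x , x<c = y≡sx , a≤x , <-trans x<c (n<1+n _)

descending-consec⁺ : ∀ {a c xs x} → Descending a c xs → x ∈ᴵ (a , c) → Consec (c ∷ xs) (suc x) x
descending-consec⁺ stop (a≤x , x<a) = ⊥-elim (<⇒≱ x<a a≤x)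
descending-consec⁺ (step desc) (a≤x , x<sc) with m≤n⇒m<n∨m≡n (s≤s⁻¹ x<sc)
... | inj₁ x<c = there (descending-consec⁺ desc (a≤x , x<c))
... | inj₂ refl = here

descending-traverses : ∀ {a c xs z} → Descending a c xs → Traverses (c ∷ xs) z (suc z) ⇔ z ∈ᴵ (a , c)
descending-traverses desc = mk⇔
  Sum.[ (λ forwards → ⊥-elim (n≢2+n (proj₁ (descending-consec⁻ desc forwards))))
      , proj₂ ∘ descending-consec⁻ desc ]
  (inj₂ ∘ descending-consec⁺ desc)

simple-walk-interval : ∀ {x xs} → Unique (x ∷ xs) → Linked Adjacent (x ∷ xs) →
  ∃ λ I → ∀ z → Traverses (x ∷ xs) z (suc z) ⇔ z ∈ᴵ I
simple-walk-interval distinct linked with ascending-or-descending distinct linked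
... | inj₁ (c , asc) = (_ , c) , λ _ → ascending-traverses asc
... | inj₂ (a , desc) = (a , _) , λ _ → descending-traverses desc

module _ {A B : Set} {f : A → B} where
  consec-map⁺ : ∀ {xs x y} → Consec xs x y → Consec (map f xs) (f x) (f y)
  consec-map⁺ here = here
  consec-map⁺ (there xy) = there (consec-map⁺ xy)

  consec-map⁻ : Injective _≡_ _≡_ f → ∀ {xs x y} → Consec (map f xs) (f x) (f y) → Consec xs x y
  consec-map⁻ f-inj {xs} fxy = go xs fxy refl refl
    where
    go : ∀ xs {a b x y} → Consec (map f xs) a b → f x ≡ a → f y ≡ b → Consec xs x y
    go [] ()
    go (_ ∷ _ ∷ _) here fx≡a fy≡b with f-inj fx≡a | f-inj fy≡b
    ... | refl | refl = here
    go (_ ∷ xs) (there ab) fx≡a fy≡b = there (go xs ab fx≡a fy≡b)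

  traverses-map : Injective _≡_ _≡_ f → ∀ {xs x y} → Traverses xs x y ⇔ Traverses (map f xs) (f x) (f y)
  traverses-map f-inj = mk⇔ (Sum.map consec-map⁺ consec-map⁺) (Sum.map (consec-map⁻ f-inj) (consec-map⁻ f-inj))

module _ {n : ℕ} where
  low : Edge (PathGraph n) → ℕ
  low (u , _) = toℕ u

  high≡suc-low : (e : Edge (PathGraph n)) → toℕ (proj₁ (proj₂ e)) ≡ suc (low e)
  high≡suc-low (_ , _ , _ , inj₁ su≡v) = sym su≡v
  high≡suc-low (_ , v , u<v , inj₂ sv≡u) = ⊥-elim (<-asym u<v (subst (toℕ v <_) sv≡u (n<1+n _)))

  suc-low<n : (e : Edge (PathGraph n)) → suc (low e) < n
  suc-low<n e@(_ , v , _) = subst (_< n) (high≡suc-low e) (toℕ<n v)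

  ≢E⇒low≢ : (e e′ : Edge (PathGraph n)) → e ≢E e′ → ¬ low e ≡ low e′
  ≢E⇒low≢ e@(_ , _ , _) e′@(_ , _ , _) e≢e′ lows≡ = e≢e′
    (toℕ-injective lows≡ ,
     toℕ-injective (trans (high≡suc-low e) (trans (cong suc lows≡) (sym (high≡suc-low e′)))))

  edgeAt : ∀ x → suc x < n → Edge (PathGraph n)
  edgeAt x sx<n = fromℕ< (<-trans (n<1+n x) sx<n) , fromℕ< sx<n ,
    subst₂ _<_ (sym (toℕ-fromℕ< _)) (sym (toℕ-fromℕ< _)) (n<1+n x) ,
    inj₁ (trans (cong suc (toℕ-fromℕ< _)) (sym (toℕ-fromℕ< _)))

  low-edgeAt : ∀ x (sx<n : suc x < n) → low (edgeAt x sx<n) ≡ x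
  low-edgeAt x sx<n = toℕ-fromℕ< _

  ∈E⇔traverses : (p : GPath (PathGraph n)) (e : Edge (PathGraph n)) →
    e ∈E p ⇔ Traverses (map toℕ (verts p)) (low e) (suc (low e))
  ∈E⇔traverses p e@(_ , _ , _) rewrite sym (high≡suc-low e) = traverses-map toℕ-injective

  path-edges : ∀ {I} (p : GPath (PathGraph n)) →
    (∀ z → Traverses (map toℕ (verts p)) z (suc z) ⇔ z ∈ᴵ I) → ∀ e → e ∈E p ⇔ low e ∈ᴵ I
  path-edges p traverses⇔ e = ⇔.trans (∈E⇔traverses p e) (traverses⇔ (low e))

  path-edges-interval : (p : GPath (PathGraph n)) → ∃ λ I → ∀ e → e ∈E p ⇔ low e ∈ᴵ I
  path-edges-interval (mkPath [] nonempty _ _) = ⊥-elim (nonempty refl)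
  path-edges-interval p@(mkPath (_ ∷ _) _ distinct linked)
    with simple-walk-interval (Unique.map⁺ toℕ-injective distinct) (Linked.map⁺ linked)
  ... | I , traverses⇔ = I , path-edges p traverses⇔

  toFins : (xs : List ℕ) → All (_< n) xs → List (Fin n)
  toFins [] _ = []
  toFins (x ∷ xs) bounded = fromℕ< (All.head bounded) ∷ toFins xs (All.tail bounded)

  map-toℕ-toFins : ∀ xs (bounded : All (_< n) xs) → map toℕ (toFins xs bounded) ≡ xs
  map-toℕ-toFins [] _ = refl
  map-toℕ-toFins (x ∷ xs) bounded = cong₂ _∷_ (toℕ-fromℕ< _) (map-toℕ-toFins xs _)

  ascending-< : ∀ {a c xs} → Ascending a c xs → c < n → All (_< n) (a ∷ xs)
  ascending-< asc c<n = All.map (λ x≤c → ≤-<-trans x≤c c<n) (ascending-≤ asc)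

  ascendingPath : ∀ {a c xs} → Ascending a c xs → c < n → GPath (PathGraph n)
  ascendingPath {a} {xs = xs} asc c<n = mkPath (toFins (a ∷ xs) bounded) (λ ())
    (Unique.map⁻ (subst Unique (sym (map-toℕ-toFins _ bounded)) (ascending-unique asc)))
    (Linked.map⁻ (subst (Linked Adjacent) (sym (map-toℕ-toFins _ bounded)) (ascending-linked asc)))
    where
    bounded : All (_< n) (a ∷ xs)
    bounded = ascending-< asc c<n

  ascendingPath-edges : ∀ {a c xs} (asc : Ascending a c xs) (c<n : c < n) →
    ∀ e → e ∈E ascendingPath asc c<n ⇔ low e ∈ᴵ (a , c)
  ascendingPath-edges {a} {c} asc c<n = path-edges (ascendingPath asc c<n) λ z →
    subst (λ ys → Traverses ys z (suc z) ⇔ z ∈ᴵ (a , c))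
      (sym (map-toℕ-toFins _ (ascending-< asc c<n))) (ascending-traverses asc)

+-self≡*2 : ∀ k → k + k ≡ k * 2
+-self≡*2 k = trans (cong (k +_) (sym (+-identityʳ k))) (*-comm 2 k)

[n/2]+[n/2]≤n : ∀ n → n / 2 + n / 2 ≤ n
[n/2]+[n/2]≤n n = subst (_≤ n) (sym (+-self≡*2 (n / 2))) (m/n*n≤m n 2)

n≤1+[n/2]+[n/2] : ∀ n → n ≤ suc (n / 2 + n / 2)
n≤1+[n/2]+[n/2] n = begin
  n                      ≡⟨ m≡m%n+[m/n]*n n 2 ⟩
  n % 2 + n / 2 * 2      ≤⟨ +-monoˡ-≤ _ (s≤s⁻¹ (m%n<n n 2)) ⟩
  suc (n / 2 * 2)        ≡⟨ cong suc (+-self≡*2 (n / 2)) ⟨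
  suc (n / 2 + n / 2)    ∎
  where open ≤-Reasoning

≤+-self⇒[1+m]/2≤ : ∀ {m L} → m ≤ L + L → suc m / 2 ≤ L
≤+-self⇒[1+m]/2≤ {m} {L} m≤2L = s≤s⁻¹ (m<n*o⇒m/o<n (s≤s (s≤s (subst (m ≤_) (+-self≡*2 L) m≤2L))))

module Windows (n : ℕ) where
  k : ℕ
  k = n / 2

  windowPath : Fin k → GPath (PathGraph n)
  windowPath j = ascendingPath (ascent-ascending (toℕ j) k)
    (<-≤-trans (+-monoʳ-< k (toℕ<n j)) ([n/2]+[n/2]≤n n))

  windowPaths : List (GPath (PathGraph n))
  windowPaths = tabulate windowPath

  low<k+k : (e : Edge (PathGraph n)) → low e < k + k
  low<k+k e = s≤s⁻¹ (<-≤-trans (suc-low<n e) (n≤1+[n/2]+[n/2] n))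

  separate-ordered : ∀ e e′ → low e < low e′ →
    ∃ λ p → p ∈ windowPaths × ExactlyOne (e ∈E p) (e′ ∈E p)
  separate-ordered e e′ lows< with windows-separate lows< (low<k+k e′)
  ... | j , j<k , one = windowPath i , ∈-tabulate⁺ i ,
    ExactlyOne-resp-⇔ (⇔.sym (edges e)) (⇔.sym (edges e′))
      (subst (λ t → ExactlyOne (low e ∈ᴵ window k t) (low e′ ∈ᴵ window k t)) (sym (toℕ-fromℕ< j<k)) one)
    where
    i : Fin k
    i = fromℕ< j<k
    edges : ∀ e → e ∈E windowPath i ⇔ low e ∈ᴵ window k (toℕ i)
    edges = ascendingPath-edges (ascent-ascending (toℕ i) k) _

  windowPaths-separating : Separating (PathGraph n) windowPaths
  windowPaths-separating e e′ e≢e′ with <-cmp (low e) (low e′)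
  ... | tri< lows< _ _ = separate-ordered e e′ lows<
  ... | tri≈ _ lows≡ _ = ⊥-elim (≢E⇒low≢ e e′ e≢e′ lows≡)
  ... | tri> _ _ lows> = map₂ (map₂ swap) (separate-ordered e′ e lows>)

separating-length-≥ : ∀ {m} → 2 ≤ m → ∀ 𝒫 → Separating (PathGraph (suc m)) 𝒫 → suc m / 2 ≤ length 𝒫
separating-length-≥ {m} 2≤m 𝒫 sep = ≤+-self⇒[1+m]/2≤ (intervals-separating⇒≤ I 2≤m separates)
  where
  I : Fin (length 𝒫) → Interval
  I j = proj₁ (path-edges-interval (lookup 𝒫 j))

  edgeAt-∈E⇔ : ∀ j x (sx<n : suc x < suc m) → edgeAt x sx<n ∈E lookup 𝒫 j ⇔ x ∈ᴵ I j
  edgeAt-∈E⇔ j x sx<n = subst (λ y → edgeAt x sx<n ∈E lookup 𝒫 j ⇔ y ∈ᴵ I j) (low-edgeAt x sx<n)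
    (proj₂ (path-edges-interval (lookup 𝒫 j)) (edgeAt x sx<n))

  separates : ∀ {x x′} → x < x′ → x′ < m → ∃ λ j → ExactlyOne (x ∈ᴵ I j) (x′ ∈ᴵ I j)
  separates {x} {x′} x<x′ x′<m = separated-by (sep e e′ e≢e′)
    where
    sx<n : suc x < suc m
    sx<n = s≤s (<-trans x<x′ x′<m)
    sx′<n : suc x′ < suc m
    sx′<n = s≤s x′<m
    e e′ : Edge (PathGraph (suc m))
    e = edgeAt x sx<n
    e′ = edgeAt x′ sx′<n
    e≢e′ : e ≢E e′
    e≢e′ (u≡u′ , _) =
      <⇒≢ x<x′ (trans (sym (low-edgeAt x sx<n)) (trans (cong toℕ u≡u′) (low-edgeAt x′ sx′<n)))
    separated-by : (∃ λ p → p ∈ 𝒫 × ExactlyOne (e ∈E p) (e′ ∈E p)) →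
      ∃ λ j → ExactlyOne (x ∈ᴵ I j) (x′ ∈ᴵ I j)
    separated-by (p , p∈𝒫 , one) = j , ExactlyOne-resp-⇔ (edgeAt-∈E⇔ j x sx<n) (edgeAt-∈E⇔ j x′ sx′<n)
      (subst (λ q → ExactlyOne (e ∈E q) (e′ ∈E q)) (lookup-index p∈𝒫) one)
      where
      j : Fin (length 𝒫)
      j = Any.index p∈𝒫

proposition2 : (n : ℕ) → 3 ≤ n → IsSepNumber (PathGraph n) (n / 2)
proposition2 (suc m) (s≤s 2≤m) =
  (windowPaths , windowPaths-separating , length-tabulate windowPath) , separating-length-≥ 2≤m
  where open Windows (suc m)
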